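{- Let $r, c, \lambda_{cc}$ be positive integers and let $\mathcal{S}$ be a symmetric 2-$(r + c, r, \lambda_{cc})$ design on a point set $V$. Fix a point $\sigma \in V$. Let $C_1, \dots, C_c$ be the blocks of $\mathcal{S}$ not containing $\sigma$, and let $R_1, \dots, R_r$ be the sets $R_i := V \setminus \overline{R_i}$, where $\overline{R_1}, \dots, \overline{R_r}$ are the blocks of $\mathcal{S}$ containing $\sigma$. Then, taking $R_1, \dots, R_r$ as row-sets and $C_1, \dots, C_c$ as column-sets (on the symbol set $V \setminus \{\sigma\}$), one obtains an $(r \times c, r + c - 1)$-unordered triple array.
   Context: A symmetric 2-$(v,k,\lambda)$ design is a collection of $v$ blocks, each a $k$-subset of a $v$-element point set, such that every pair of distinct points lies in exactly $\lambda$ blocks. An $(r \times c, v)$-unordered triple array on a set $V'$ of $v$ symbols is a collection of $c$-subsets $R_1, \dots, R_r \subseteq V'$ (row-sets) and $r$-subsets $C_1, \dots, C_c \subseteq V'$ (column-sets) such that, for some integers $e, \lambda_{rc}, \lambda_{rr}, \lambda_{cc}$, each symbol lies in exactly $e$ row-sets and exactly $e$ column-sets, $|R_i \cap C_j| = \lambda_{rc}$ for all $i,j$, $|R_i \cap R_s| = \lambda_{rr}$ for all $i \neq s$, and $|C_j \cap C_t| = \lambda_{cc}$ for all $j \neq t$. -}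

module Defs where

open import Data.Nat using (ℕ)
open import Data.Fin using (Fin)
open import Data.Fin.Subset using (Subset; _∈_; ∣_∣; _∩_; _⊆_)
open import Data.Vec using (tabulate; lookup)
open import Data.Bool using (Bool; _∧_)
open import Data.Product using (∃; _×_)
open import Relation.Binary.PropositionalEquality using (_≡_)
open import Relation.Nullary using (¬_)
open import Function.Definitions using (Injective)

count : ∀ {m} → (Fin m → Bool) → ℕ
count p = ∣ tabulate p ∣

-- A symmetric 2-(v,k,λ) design: v blocks (indexed by Fin v, repetitions allowed
-- a priori) on the point set Fin v, each of size k, every pair of distinct
-- points lying in exactly λ blocks.
record IsSymmetricDesign (v k lam : ℕ) (B : Fin v → Subset v) : Set where
  field
    blockSize : ∀ b → ∣ B b ∣ ≡ k
    pairCount : ∀ x y → ¬ x ≡ y →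
                count (λ b → lookup (B b) x ∧ lookup (B b) y) ≡ lam

record IsUnorderedTripleArray {N : ℕ} (r c v : ℕ) (V' : Subset N)
       (R : Fin r → Subset N) (C : Fin c → Subset N) : Set where
  field
    symbolCount : ∣ V' ∣ ≡ v
    rowsIn      : ∀ i → R i ⊆ V'
    colsIn      : ∀ j → C j ⊆ V'
    rowSize     : ∀ i → ∣ R i ∣ ≡ c
    colSize     : ∀ j → ∣ C j ∣ ≡ r
    e λrc λrr λcc : ℕ
    rowRep      : ∀ x → x ∈ V' → count (λ i → lookup (R i) x) ≡ e
    colRep      : ∀ x → x ∈ V' → count (λ j → lookup (C j) x) ≡ e
    rowCol      : ∀ i j → ∣ R i ∩ C j ∣ ≡ λrc
    rowRow      : ∀ i s → ¬ i ≡ s → ∣ R i ∩ R s ∣ ≡ λrr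
    colCol      : ∀ j t → ¬ j ≡ t → ∣ C j ∩ C t ∣ ≡ λcc

Enumerates : ∀ {m v} → (Fin m → Fin v) → (Fin v → Set) → Set
Enumerates f P = Injective _≡_ _≡_ f × (∀ i → P (f i)) × (∀ b → P b → ∃ λ i → f i ≡ b)

-- Counting the pairs (b, y) with x, y ∈ B b gives r_x k + λ = v λ + r_x for the number r_x of
-- blocks through x. With λ > 0 and v ≥ 2 this forces k ≥ 2, and then all r_x are equal, hence
-- equal to k. For a fixed block a the intersection sizes X_b = |B_a ∩ B_b| satisfy Σ X_b = k²
-- and Σ X_b² = k² + k(k − 1)λ, so the X_b with b ≠ a have mean λ and variance 0: distinct
-- blocks meet in exactly λ points. Every parameter of the triple array is then an incidence
-- count obtained by inclusion–exclusion: e = λrc = k − λ, λrr = v − 2k + λ and λcc = λ.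

module Submission where

open import Algebra.Properties.CommutativeSemigroup using (xy∙z≈zy∙x; xy∙z≈xz∙y)
open import Data.Bool using (Bool; true; false; not; _∧_)
open import Data.Fin using (Fin; zero; suc; punchIn; _≟_; fromℕ<)
open import Data.Fin.Properties using (suc-injective; punchInᵢ≢i; nonZeroIndex)
open import Data.Fin.Subset using (Subset; _∈_; _∉_; ∁; ⁅_⁆; _∩_; _⊆_; ∣_∣)
open import Data.Fin.Subset.Properties
  using (_∈?_; x∈∁p⇒x∉p; x∉p⇒x∈∁p; x∈p⇒x∉∁p; x∈⁅y⁆⇒x≡y; x∉⁅y⁆⇒x≢y; ∣∁p∣≡n∸∣p∣; ∣⁅x⁆∣≡1)
open import Data.Nat using (ℕ; zero; suc; _+_; _*_; _∸_; _≤_; _<_; z≤n; s≤s; ∣_-_∣; >-nonZero)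
open import Data.Nat.Properties
  using ( +-comm; +-assoc; +-identityʳ; *-identityˡ; *-identityʳ; *-zeroʳ; *-assoc; *-distribˡ-+; *-distribʳ-+
        ; +-cancelˡ-≡; +-cancelʳ-≡; *-cancelˡ-≡; *-cancelʳ-≡; +-cancelʳ-≤
        ; ≤-reflexive; ≤-trans; ≤-antisym; ≤-total; <⇒≤; <⇒≱; ≰⇒>; m≤m+n
        ; +-mono-≤; +-monoˡ-≤; +-monoʳ-≤; *-monoʳ-≤; *-monoˡ-<
        ; m+n∸n≡m; m+n∸m≡n; m+[n∸m]≡n; ∣m-m+n∣≡n; ∣-∣-comm; ∣m-n∣≡0⇒m≡n; m*n≡0⇒m≡0∨n≡0
        ; +-*-semiring; +-commutativeSemigroup; module ≤-Reasoning )
open import Data.Nat.Tactic.RingSolver using (solve-∀)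
open import Data.Product using (Σ; ∃; _×_; _,_; proj₁; proj₂)
open import Data.Sum using (inj₁; inj₂; reduce)
open import Data.Vec using ([]; _∷_; lookup; tabulate)
open import Data.Vec.Functional using (updateAt) renaming (_∷_ to _∷ᶠ_)
open import Data.Vec.Functional.Properties using (updateAt-updates; updateAt-minimal)
open import Data.Vec.Properties using (lookup-map; lookup-zipWith; lookup∘tabulate)
open import Function using (_∘_; _⇔_; mk⇔)
open import Function.Definitions using (Injective)
open import Relation.Binary.PropositionalEquality
  using (_≡_; _≢_; refl; sym; trans; cong; cong₂; subst; module ≡-Reasoning)
open import Relation.Nullary using (¬_; yes; no; does; ¬?; contradiction)
open import Relation.Nullary.Decidable using (dec-true; dec-false; does-⇔)
open import Relation.Unary using (Decidable)

open import Defs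

open import Algebra.Properties.Semiring.Sum +-*-semiring
  using (sum; sum-syntax; sum-cong-≗; sum-remove; ∑-distrib-+; ∑-comm; *-distribˡ-sum; *-distribʳ-sum)

m+n≡o⇒m≡o∸n : ∀ {m n o} → m + n ≡ o → m ≡ o ∸ n
m+n≡o⇒m≡o∸n {m} {n} eq = trans (sym (m+n∸n≡m m n)) (cong (_∸ n) eq)

x²+l²≡2lx+∣x-l∣² : ∀ x l → x * x + l * l ≡ 2 * l * x + ∣ x - l ∣ * ∣ x - l ∣
x²+l²≡2lx+∣x-l∣² x l with ≤-total x l
... | inj₁ x≤l with l ∸ x | m+[n∸m]≡n x≤l
...   | d | refl rewrite ∣m-m+n∣≡n x d = expand x d
  where
  expand : ∀ x d → x * x + (x + d) * (x + d) ≡ 2 * (x + d) * x + d * d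
  expand = solve-∀
x²+l²≡2lx+∣x-l∣² x l | inj₂ l≤x with x ∸ l | m+[n∸m]≡n l≤x
...   | d | refl rewrite ∣-∣-comm (l + d) l | ∣m-m+n∣≡n l d = expand l d
  where
  expand : ∀ l d → (l + d) * (l + d) + l * l ≡ 2 * l * (l + d) + d * d
  expand = solve-∀

2lx≤x²+l² : ∀ x l → 2 * l * x ≤ x * x + l * l
2lx≤x²+l² x l = ≤-trans (m≤m+n _ _) (≤-reflexive (sym (x²+l²≡2lx+∣x-l∣² x l)))

x²+l²≡2lx⇒x≡l : ∀ {x l} → x * x + l * l ≡ 2 * l * x → x ≡ l
x²+l²≡2lx⇒x≡l {x} {l} eq = ∣m-n∣≡0⇒m≡n (reduce (m*n≡0⇒m≡0∨n≡0 ∣ x - l ∣ ∣x-l∣²≡0))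
  where
  ∣x-l∣²≡0 : ∣ x - l ∣ * ∣ x - l ∣ ≡ 0
  ∣x-l∣²≡0 = +-cancelˡ-≡ (2 * l * x) _ 0
    (trans (sym (x²+l²≡2lx+∣x-l∣² x l)) (trans eq (sym (+-identityʳ _))))

R*k+l≡v*l+R⇒1<k : ∀ {R k v l} → 1 < v → 0 < l → R * k + l ≡ v * l + R → 1 < k
R*k+l≡v*l+R⇒1<k {R} {k} {v} {l} 1<v 0<l eq = ≰⇒> λ k≤1 → <⇒≱ l<v*l (+-cancelʳ-≤ R _ _ (begin
  v * l + R  ≡⟨ eq ⟨
  R * k + l  ≤⟨ +-monoˡ-≤ l (*-monoʳ-≤ R k≤1) ⟩
  R * 1 + l  ≡⟨ cong (_+ l) (*-identityʳ R) ⟩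
  R + l      ≡⟨ +-comm R l ⟩
  l + R      ∎))
  where
  open ≤-Reasoning
  l<v*l : l < v * l
  l<v*l = subst (_< v * l) (*-identityˡ l) (*-monoˡ-< l ⦃ >-nonZero 0<l ⦄ 1<v)

m*k+l≡c+m⇒n*k+l≡c+n⇒m≡n : ∀ {m n k l c} → 1 < k → m * k + l ≡ c + m → n * k + l ≡ c + n → m ≡ n
m*k+l≡c+m⇒n*k+l≡c+n⇒m≡n {m} {n} {suc k} {l} {c} (s≤s (s≤s _)) eqm eqn =
  *-cancelʳ-≡ m n k (+-cancelʳ-≡ (m + n + l) _ _ (begin
    m * k + (m + n + l)    ≡⟨ rearrange m n k l ⟨
    m * suc k + l + n      ≡⟨ cong (_+ n) eqm ⟩
    c + m + n              ≡⟨ xy∙z≈xz∙y +-commutativeSemigroup c m n ⟩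
    c + n + m              ≡⟨ cong (_+ m) eqn ⟨
    n * suc k + l + m      ≡⟨ rearrange n m k l ⟩
    n * k + (n + m + l)    ≡⟨ cong (λ s → n * k + (s + l)) (+-comm n m) ⟩
    n * k + (m + n + l)    ∎))
  where
  open ≡-Reasoning
  rearrange : ∀ a b k l → a * suc k + l + b ≡ a * k + (a + b + l)
  rearrange = solve-∀

∑-const : ∀ n x → ∑[ i < n ] x ≡ n * x
∑-const zero    x = refl
∑-const (suc n) x = cong (x +_) (∑-const n x)

∑-*-∑-comm : ∀ {m n} (f : Fin m → ℕ) (g : Fin m → Fin n → ℕ) →
             ∑[ i < m ] (f i * ∑[ j < n ] g i j) ≡ ∑[ j < n ] ∑[ i < m ] (f i * g i j)
∑-*-∑-comm f g = trans (sum-cong-≗ (λ i → *-distribˡ-sum (f i) (g i))) (∑-comm (λ i j → f i * g i j))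

∑-square-expand : ∀ {m n} (w : Fin n → ℕ) (M : Fin m → Fin n → ℕ) →
  ∑[ i < m ] (∑[ x < n ] (w x * M i x) * ∑[ y < n ] (w y * M i y))
  ≡ ∑[ x < n ] (w x * ∑[ y < n ] (w y * ∑[ i < m ] (M i x * M i y)))
∑-square-expand {m} {n} w M = begin
  ∑[ i < m ] (∑[ x < n ] (w x * M i x) * S i)
    ≡⟨ sum-cong-≗ (λ i → *-distribʳ-sum (S i) (λ x → w x * M i x)) ⟩
  ∑[ i < m ] ∑[ x < n ] (w x * M i x * S i)
    ≡⟨ ∑-comm (λ i x → w x * M i x * S i) ⟩
  ∑[ x < n ] ∑[ i < m ] (w x * M i x * S i)
    ≡⟨ sum-cong-≗ (λ x → ∑-*-∑-comm (λ i → w x * M i x) (λ i y → w y * M i y)) ⟩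
  ∑[ x < n ] ∑[ y < n ] ∑[ i < m ] (w x * M i x * (w y * M i y))
    ≡⟨ sum-cong-≗ (λ x → sum-cong-≗ (λ y → pull-out (w x) (w y) (λ i → M i x) (λ i → M i y))) ⟩
  ∑[ x < n ] ∑[ y < n ] (w x * (w y * ∑[ i < m ] (M i x * M i y)))
    ≡⟨ sum-cong-≗ (λ x → *-distribˡ-sum (w x) (λ y → w y * ∑[ i < m ] (M i x * M i y))) ⟨
  ∑[ x < n ] (w x * ∑[ y < n ] (w y * ∑[ i < m ] (M i x * M i y))) ∎
  where
  open ≡-Reasoning
  S : Fin m → ℕ
  S i = ∑[ y < n ] (w y * M i y)
  pull-out : ∀ a b (c d : Fin m → ℕ) → ∑[ i < m ] (a * c i * (b * d i)) ≡ a * (b * ∑[ i < m ] (c i * d i))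
  pull-out a b c d = begin
    ∑[ i < m ] (a * c i * (b * d i))     ≡⟨ sum-cong-≗ (λ i → rearrange a b (c i) (d i)) ⟩
    ∑[ i < m ] (a * (b * (c i * d i)))   ≡⟨ *-distribˡ-sum a (λ i → b * (c i * d i)) ⟨
    a * ∑[ i < m ] (b * (c i * d i))     ≡⟨ cong (a *_) (*-distribˡ-sum b (λ i → c i * d i)) ⟨
    a * (b * ∑[ i < m ] (c i * d i))     ∎
    where
    rearrange : ∀ a b c d → a * c * (b * d) ≡ a * (b * (c * d))
    rearrange = solve-∀

∑-differ-at : ∀ {n} (a : Fin n) (f g : Fin n → ℕ) → (∀ i → i ≢ a → f i ≡ g i) →
              sum f + g a ≡ sum g + f a
∑-differ-at {suc n} a f g f≡g = begin
  sum f + g a                      ≡⟨ cong (_+ g a) (sum-remove {i = a} f) ⟩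
  f a + sum (f ∘ punchIn a) + g a  ≡⟨ cong (λ s → f a + s + g a) (sum-cong-≗ (λ j → f≡g _ (punchInᵢ≢i a j))) ⟩
  f a + sum (g ∘ punchIn a) + g a  ≡⟨ xy∙z≈zy∙x +-commutativeSemigroup (f a) _ (g a) ⟩
  g a + sum (g ∘ punchIn a) + f a  ≡⟨ cong (_+ f a) (sum-remove {i = a} g) ⟨
  sum g + f a                      ∎
  where open ≡-Reasoning

∑-mono-≤ : ∀ {n} {f g : Fin n → ℕ} → (∀ i → f i ≤ g i) → sum f ≤ sum g
∑-mono-≤ {zero}  f≤g = z≤n
∑-mono-≤ {suc n} f≤g = +-mono-≤ (f≤g zero) (∑-mono-≤ (f≤g ∘ suc))

∑-mono-≤-≡ : ∀ {n} {f g : Fin n → ℕ} → (∀ i → f i ≤ g i) → sum f ≡ sum g → ∀ i → f i ≡ g i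
∑-mono-≤-≡ {suc n} {f} {g} f≤g ∑f≡∑g = λ where
    zero    → f₀≡g₀
    (suc i) → ∑-mono-≤-≡ (f≤g ∘ suc) (+-cancelˡ-≡ (f zero) _ _ (trans ∑f≡∑g (cong (_+ _) (sym f₀≡g₀)))) i
  where
  f₀≡g₀ : f zero ≡ g zero
  f₀≡g₀ = ≤-antisym (f≤g zero) (+-cancelʳ-≤ _ _ _
    (≤-trans (≤-reflexive (sym ∑f≡∑g)) (+-monoʳ-≤ (f zero) (∑-mono-≤ (f≤g ∘ suc)))))

∑≡n*l⇒∑²≡n*l²⇒≡l : ∀ {n} (x : Fin n → ℕ) l → ∑[ i < n ] x i ≡ n * l →
                   ∑[ i < n ] (x i * x i) ≡ n * (l * l) → ∀ i → x i ≡ l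
∑≡n*l⇒∑²≡n*l²⇒≡l {n} x l ∑x≡nl ∑x²≡nl² i =
  x²+l²≡2lx⇒x≡l (sym (∑-mono-≤-≡ (λ i → 2lx≤x²+l² (x i) l) ∑2lx≡∑[x²+l²] i))
  where
  ∑2lx≡∑[x²+l²] : ∑[ i < n ] (2 * l * x i) ≡ ∑[ i < n ] (x i * x i + l * l)
  ∑2lx≡∑[x²+l²] = begin
    ∑[ i < n ] (2 * l * x i)               ≡⟨ *-distribˡ-sum (2 * l) x ⟨
    2 * l * ∑[ i < n ] x i                 ≡⟨ cong (2 * l *_) ∑x≡nl ⟩
    2 * l * (n * l)                        ≡⟨ twice n l ⟩
    n * (l * l) + n * (l * l)              ≡⟨ cong₂ _+_ ∑x²≡nl² (∑-const n (l * l)) ⟨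
    ∑[ i < n ] (x i * x i) + ∑[ i < n ] (l * l) ≡⟨ ∑-distrib-+ (λ i → x i * x i) (λ _ → l * l) ⟨
    ∑[ i < n ] (x i * x i + l * l)          ∎
    where
    open ≡-Reasoning
    twice : ∀ n l → 2 * l * (n * l) ≡ n * (l * l) + n * (l * l)
    twice = solve-∀

𝟙 : Bool → ℕ
𝟙 true  = 1
𝟙 false = 0

𝟙-∧ : ∀ a b → 𝟙 (a ∧ b) ≡ 𝟙 a * 𝟙 b
𝟙-∧ true  b = sym (+-identityʳ (𝟙 b))
𝟙-∧ false b = refl

𝟙-idem : ∀ a → 𝟙 a * 𝟙 a ≡ 𝟙 a
𝟙-idem true  = refl
𝟙-idem false = refl

𝟙-not : ∀ a → 𝟙 (not a) + 𝟙 a ≡ 1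
𝟙-not true  = refl
𝟙-not false = refl

lookup-∩ : ∀ {n} (p q : Subset n) x → lookup (p ∩ q) x ≡ lookup p x ∧ lookup q x
lookup-∩ p q x = lookup-zipWith _∧_ x p q

lookup-∁ : ∀ {n} (p : Subset n) x → lookup (∁ p) x ≡ not (lookup p x)
lookup-∁ p x = lookup-map x not p

𝟙-∁ : ∀ {n} (p : Subset n) x → 𝟙 (lookup (∁ p) x) + 𝟙 (lookup p x) ≡ 1
𝟙-∁ p x = trans (cong (λ b → 𝟙 b + 𝟙 (lookup p x)) (lookup-∁ p x)) (𝟙-not (lookup p x))

∣p∣≡∑𝟙 : ∀ {n} (p : Subset n) → ∣ p ∣ ≡ ∑[ x < n ] 𝟙 (lookup p x)
∣p∣≡∑𝟙 []          = refl
∣p∣≡∑𝟙 (true  ∷ p) = cong suc (∣p∣≡∑𝟙 p)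
∣p∣≡∑𝟙 (false ∷ p) = ∣p∣≡∑𝟙 p

count≡∑𝟙 : ∀ {m} (p : Fin m → Bool) → count p ≡ ∑[ i < m ] 𝟙 (p i)
count≡∑𝟙 p = trans (∣p∣≡∑𝟙 (tabulate p)) (sum-cong-≗ (cong 𝟙 ∘ lookup∘tabulate p))

does-∈? : ∀ {n} (x : Fin n) (p : Subset n) → does (x ∈? p) ≡ lookup p x
does-∈? zero    (true  ∷ p) = refl
does-∈? zero    (false ∷ p) = refl
does-∈? (suc x) (_     ∷ p) = does-∈? x p

∣p∩q∣≡∑𝟙*𝟙 : ∀ {n} (p q : Subset n) → ∣ p ∩ q ∣ ≡ ∑[ x < n ] (𝟙 (lookup p x) * 𝟙 (lookup q x))
∣p∩q∣≡∑𝟙*𝟙 p q = trans (∣p∣≡∑𝟙 (p ∩ q)) (sum-cong-≗ λ x →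
  trans (cong 𝟙 (lookup-∩ p q x)) (𝟙-∧ (lookup p x) (lookup q x)))

∣∁p∩q∣+∣p∩q∣≡∣q∣ : ∀ {n} (p q : Subset n) → ∣ ∁ p ∩ q ∣ + ∣ p ∩ q ∣ ≡ ∣ q ∣
∣∁p∩q∣+∣p∩q∣≡∣q∣ {n} p q = begin
  ∣ ∁ p ∩ q ∣ + ∣ p ∩ q ∣
    ≡⟨ cong₂ _+_ (∣p∣≡∑𝟙 (∁ p ∩ q)) (∣p∣≡∑𝟙 (p ∩ q)) ⟩
  ∑[ x < n ] 𝟙 (lookup (∁ p ∩ q) x) + ∑[ x < n ] 𝟙 (lookup (p ∩ q) x)
    ≡⟨ ∑-distrib-+ (𝟙 ∘ lookup (∁ p ∩ q)) (𝟙 ∘ lookup (p ∩ q)) ⟨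
  ∑[ x < n ] (𝟙 (lookup (∁ p ∩ q) x) + 𝟙 (lookup (p ∩ q) x))
    ≡⟨ sum-cong-≗ pointwise ⟩
  ∑[ x < n ] 𝟙 (lookup q x)
    ≡⟨ ∣p∣≡∑𝟙 q ⟨
  ∣ q ∣ ∎
  where
  open ≡-Reasoning
  boolean : ∀ a b → 𝟙 (not a ∧ b) + 𝟙 (a ∧ b) ≡ 𝟙 b
  boolean true  b = refl
  boolean false b = +-identityʳ (𝟙 b)
  pointwise : ∀ x → 𝟙 (lookup (∁ p ∩ q) x) + 𝟙 (lookup (p ∩ q) x) ≡ 𝟙 (lookup q x)
  pointwise x rewrite lookup-∩ (∁ p) q x | lookup-∁ p x | lookup-∩ p q x = boolean (lookup p x) (lookup q x)

∣∁p∩∁q∣+[∣p∣+∣q∣]≡n+∣p∩q∣ : ∀ {n} (p q : Subset n) → ∣ ∁ p ∩ ∁ q ∣ + (∣ p ∣ + ∣ q ∣) ≡ n + ∣ p ∩ q ∣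
∣∁p∩∁q∣+[∣p∣+∣q∣]≡n+∣p∩q∣ {n} p q = begin
  ∣ ∁ p ∩ ∁ q ∣ + (∣ p ∣ + ∣ q ∣)
    ≡⟨ cong₂ _+_ (∣p∣≡∑𝟙 (∁ p ∩ ∁ q)) (cong₂ _+_ (∣p∣≡∑𝟙 p) (∣p∣≡∑𝟙 q)) ⟩
  ∑[ x < n ] 𝟙 (lookup (∁ p ∩ ∁ q) x) + (∑[ x < n ] 𝟙 (lookup p x) + ∑[ x < n ] 𝟙 (lookup q x))
    ≡⟨ cong (∑[ x < n ] 𝟙 (lookup (∁ p ∩ ∁ q) x) +_) (∑-distrib-+ (𝟙 ∘ lookup p) (𝟙 ∘ lookup q)) ⟨
  ∑[ x < n ] 𝟙 (lookup (∁ p ∩ ∁ q) x) + ∑[ x < n ] (𝟙 (lookup p x) + 𝟙 (lookup q x))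
    ≡⟨ ∑-distrib-+ (𝟙 ∘ lookup (∁ p ∩ ∁ q)) (λ x → 𝟙 (lookup p x) + 𝟙 (lookup q x)) ⟨
  ∑[ x < n ] (𝟙 (lookup (∁ p ∩ ∁ q) x) + (𝟙 (lookup p x) + 𝟙 (lookup q x)))
    ≡⟨ sum-cong-≗ pointwise ⟩
  ∑[ x < n ] (1 + 𝟙 (lookup (p ∩ q) x))
    ≡⟨ ∑-distrib-+ (λ _ → 1) (𝟙 ∘ lookup (p ∩ q)) ⟩
  ∑[ x < n ] 1 + ∑[ x < n ] 𝟙 (lookup (p ∩ q) x)
    ≡⟨ cong₂ _+_ (trans (∑-const n 1) (*-identityʳ n)) (sym (∣p∣≡∑𝟙 (p ∩ q))) ⟩
  n + ∣ p ∩ q ∣ ∎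
  where
  open ≡-Reasoning
  boolean : ∀ a b → 𝟙 (not a ∧ not b) + (𝟙 a + 𝟙 b) ≡ 1 + 𝟙 (a ∧ b)
  boolean true  true  = refl
  boolean true  false = refl
  boolean false true  = refl
  boolean false false = refl
  pointwise : ∀ x → 𝟙 (lookup (∁ p ∩ ∁ q) x) + (𝟙 (lookup p x) + 𝟙 (lookup q x)) ≡ 1 + 𝟙 (lookup (p ∩ q) x)
  pointwise x rewrite lookup-∩ (∁ p) (∁ q) x | lookup-∁ p x | lookup-∁ q x | lookup-∩ p q x =
    boolean (lookup p x) (lookup q x)

x∉p⇒p⊆∁⁅x⁆ : ∀ {n} {x : Fin n} {p : Subset n} → x ∉ p → p ⊆ ∁ ⁅ x ⁆
x∉p⇒p⊆∁⁅x⁆ {x = x} {p} x∉p {y} y∈p =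
  x∉p⇒x∈∁p λ y∈⁅x⁆ → x∉p (subst (_∈ p) (x∈⁅y⁆⇒x≡y x y∈⁅x⁆) y∈p)

δ : ∀ {n} → Fin n → Fin n → ℕ
δ i j = 𝟙 (does (i ≟ j))

∑-δ : ∀ {n} (j : Fin n) (g : Fin n → ℕ) → ∑[ i < n ] (δ i j * g i) ≡ g j
∑-δ {n} j g = +-cancelʳ-≡ 0 _ _ (begin
  ∑[ i < n ] (δ i j * g i) + 0  ≡⟨ ∑-differ-at j _ (λ _ → 0) δ≡0 ⟩
  ∑[ i < n ] 0 + δ j j * g j    ≡⟨ cong₂ _+_ (∑-const n 0) (cong (λ b → 𝟙 b * g j) (dec-true (j ≟ j) refl)) ⟩
  n * 0 + 1 * g j               ≡⟨ cong₂ _+_ (*-zeroʳ n) (*-identityˡ (g j)) ⟩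
  0 + g j                       ≡⟨ +-comm 0 (g j) ⟩
  g j + 0                       ∎)
  where
  open ≡-Reasoning
  δ≡0 : ∀ i → i ≢ j → δ i j * g i ≡ 0
  δ≡0 i i≢j = cong (λ b → 𝟙 b * g i) (dec-false (i ≟ j) i≢j)

∑-Enumerates : ∀ {m n} {P : Fin n → Set} (P? : Decidable P) {f : Fin m → Fin n} →
               Enumerates f P → ∀ g → ∑[ i < m ] g (f i) ≡ ∑[ b < n ] (𝟙 (does (P? b)) * g b)
∑-Enumerates {m} {n} {P} P? {f} (f-injective , f∈P , P⊆f) g = begin
  ∑[ i < m ] g (f i)                         ≡⟨ sum-cong-≗ (λ i → ∑-δ (f i) g) ⟨
  ∑[ i < m ] ∑[ b < n ] (δ b (f i) * g b)    ≡⟨ ∑-comm (λ i b → δ b (f i) * g b) ⟩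
  ∑[ b < n ] ∑[ i < m ] (δ b (f i) * g b)    ≡⟨ sum-cong-≗ (λ b → *-distribʳ-sum (g b) (λ i → δ b (f i))) ⟨
  ∑[ b < n ] (∑[ i < m ] δ b (f i) * g b)    ≡⟨ sum-cong-≗ (λ b → cong (_* g b) (multiplicity b)) ⟩
  ∑[ b < n ] (𝟙 (does (P? b)) * g b)         ∎
  where
  open ≡-Reasoning
  multiplicity : ∀ b → ∑[ i < m ] δ b (f i) ≡ 𝟙 (does (P? b))
  multiplicity b with P? b
  ... | yes Pb = let (i₀ , fi₀≡b) = P⊆f b Pb in begin
    ∑[ i < m ] δ b (f i)        ≡⟨ sum-cong-≗ (λ i → cong 𝟙 (does-⇔ (hit i₀ fi₀≡b i) (b ≟ f i) (i ≟ i₀))) ⟩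
    ∑[ i < m ] δ i i₀           ≡⟨ sum-cong-≗ (λ i → *-identityʳ (δ i i₀)) ⟨
    ∑[ i < m ] (δ i i₀ * 1)     ≡⟨ ∑-δ i₀ (λ _ → 1) ⟩
    1                           ∎
    where
    hit : ∀ i₀ → f i₀ ≡ b → ∀ i → b ≡ f i ⇔ i ≡ i₀
    hit i₀ refl i = mk⇔ (λ fi₀≡fi → f-injective (sym fi₀≡fi)) (λ i≡i₀ → cong f (sym i≡i₀))
  ... | no ¬Pb = begin
    ∑[ i < m ] δ b (f i)        ≡⟨ sum-cong-≗ (λ i → cong 𝟙 (dec-false (b ≟ f i) (miss i))) ⟩
    ∑[ i < m ] 0                ≡⟨ ∑-const m 0 ⟩
    m * 0                       ≡⟨ *-zeroʳ m ⟩
    0                           ∎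
    where
    miss : ∀ i → b ≢ f i
    miss i b≡fi = ¬Pb (subst P (sym b≡fi) (f∈P i))

Enumeration : ∀ {n} → ℕ → (Fin n → Set) → Set
Enumeration {n} m P = Σ (Fin m → Fin n) λ f → Enumerates f P

Enumerates-suc : ∀ {m n} {P : Fin (suc n) → Set} {f : Fin m → Fin n} →
                 ¬ P zero → Enumerates f (P ∘ suc) → Enumerates (suc ∘ f) P
Enumerates-suc ¬P0 (f-injective , f∈P , P⊆f) =
    f-injective ∘ suc-injective
  , f∈P
  , λ where
      zero    P0  → contradiction P0 ¬P0
      (suc b) Psb → let (i , fi≡b) = P⊆f b Psb in i , cong suc fi≡b

Enumerates-∷ : ∀ {m n} {P : Fin (suc n) → Set} {f : Fin m → Fin n} →
               P zero → Enumerates f (P ∘ suc) → Enumerates (zero ∷ᶠ suc ∘ f) P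
Enumerates-∷ {P = P} {f} P0 (f-injective , f∈P , P⊆f) = injective , ∈P , complete
  where
  injective : Injective _≡_ _≡_ (zero ∷ᶠ suc ∘ f)
  injective {zero}  {zero}  _ = refl
  injective {suc i} {suc j} e = cong suc (f-injective (suc-injective e))
  ∈P : ∀ i → P ((zero ∷ᶠ suc ∘ f) i)
  ∈P zero    = P0
  ∈P (suc i) = f∈P i
  complete : ∀ b → P b → ∃ λ i → (zero ∷ᶠ suc ∘ f) i ≡ b
  complete zero    _   = zero , refl
  complete (suc b) Psb = let (i , fi≡b) = P⊆f b Psb in suc i , cong suc fi≡b

enumerate : ∀ {n} {P : Fin n → Set} (P? : Decidable P) → Enumeration (∑[ b < n ] 𝟙 (does (P? b))) P
enumerate {zero}  P? = (λ ()) , (λ { {()} }) , (λ ()) , (λ ())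
enumerate {suc n} {P} P? with P? zero | enumerate {P = P ∘ suc} (P? ∘ suc)
... | yes P0 | f , f-enum = zero ∷ᶠ suc ∘ f , Enumerates-∷ P0 f-enum
... | no ¬P0 | f , f-enum = suc ∘ f , Enumerates-suc ¬P0 f-enum

module SymmetricDesign {v k lam : ℕ} {B : Fin v → Subset v} (D : IsSymmetricDesign v k lam B) where
  open IsSymmetricDesign D
  open ≡-Reasoning

  N : Fin v → Fin v → ℕ
  N b x = 𝟙 (lookup (B b) x)

  replication : Fin v → ℕ
  replication x = ∑[ b < v ] N b x

  concurrence : Fin v → Fin v → ℕ
  concurrence x y = ∑[ b < v ] (N b x * N b y)

  intersection : Fin v → Fin v → ℕ
  intersection a b = ∑[ x < v ] (N a x * N b x)

  ∑N≡k : ∀ b → ∑[ x < v ] N b x ≡ k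
  ∑N≡k b = trans (sym (∣p∣≡∑𝟙 (B b))) (blockSize b)

  ∑N*≡k* : ∀ b c → ∑[ x < v ] (N b x * c) ≡ k * c
  ∑N*≡k* b c = trans (sym (*-distribʳ-sum c (N b))) (cong (_* c) (∑N≡k b))

  N*N*≡N* : ∀ b x c → N b x * (N b x * c) ≡ N b x * c
  N*N*≡N* b x c = trans (sym (*-assoc (N b x) (N b x) c)) (cong (_* c) (𝟙-idem (lookup (B b) x)))

  concurrence≡lam : ∀ {x y} → x ≢ y → concurrence x y ≡ lam
  concurrence≡lam {x} {y} x≢y = begin
    concurrence x y                                   ≡⟨ sum-cong-≗ (λ b → 𝟙-∧ (lookup (B b) x) (lookup (B b) y)) ⟨
    ∑[ b < v ] 𝟙 (lookup (B b) x ∧ lookup (B b) y)    ≡⟨ count≡∑𝟙 (λ b → lookup (B b) x ∧ lookup (B b) y) ⟨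
    count (λ b → lookup (B b) x ∧ lookup (B b) y)     ≡⟨ pairCount x y x≢y ⟩
    lam                                               ∎

  concurrence-diag : ∀ x → concurrence x x ≡ replication x
  concurrence-diag x = sum-cong-≗ (λ b → 𝟙-idem (lookup (B b) x))

  intersection-diag : ∀ a → intersection a a ≡ k
  intersection-diag a = trans (sum-cong-≗ (λ x → 𝟙-idem (lookup (B a) x))) (∑N≡k a)

  replication-equation : ∀ x → replication x * k + lam ≡ v * lam + replication x
  replication-equation x = begin
    replication x * k + lam                           ≡⟨ cong (_+ lam) double-count ⟩
    ∑[ y < v ] concurrence x y + lam                  ≡⟨ ∑-differ-at x _ _ (λ y y≢x → concurrence≡lam (y≢x ∘ sym)) ⟩
    ∑[ y < v ] lam + concurrence x x                  ≡⟨ cong₂ _+_ (∑-const v lam) (concurrence-diag x) ⟩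
    v * lam + replication x                           ∎
    where
    double-count : replication x * k ≡ ∑[ y < v ] concurrence x y
    double-count = begin
      replication x * k                               ≡⟨ *-distribʳ-sum k (λ b → N b x) ⟩
      ∑[ b < v ] (N b x * k)                          ≡⟨ sum-cong-≗ (λ b → cong (N b x *_) (∑N≡k b)) ⟨
      ∑[ b < v ] (N b x * ∑[ y < v ] N b y)           ≡⟨ ∑-*-∑-comm (λ b → N b x) N ⟩
      ∑[ y < v ] concurrence x y                      ∎

  1<v⇒0<lam⇒1<k : 1 < v → 0 < lam → 1 < k
  1<v⇒0<lam⇒1<k 1<v 0<lam = R*k+l≡v*l+R⇒1<k 1<v 0<lam (replication-equation (fromℕ< (<⇒≤ 1<v)))

  module _ (1<k : 1 < k) where

    replication≡k : ∀ x → replication x ≡ k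
    replication≡k x = *-cancelˡ-≡ _ _ v ⦃ nonZeroIndex x ⦄ (begin
      v * replication x                               ≡⟨ ∑-const v (replication x) ⟨
      ∑[ y < v ] replication x                        ≡⟨ sum-cong-≗ replication-constant ⟩
      ∑[ y < v ] replication y                        ≡⟨ ∑-comm (λ y b → N b y) ⟩
      ∑[ b < v ] ∑[ y < v ] N b y                     ≡⟨ sum-cong-≗ ∑N≡k ⟩
      ∑[ b < v ] k                                    ≡⟨ ∑-const v k ⟩
      v * k                                           ∎)
      where
      replication-constant : ∀ y → replication x ≡ replication y
      replication-constant y =
        m*k+l≡c+m⇒n*k+l≡c+n⇒m≡n 1<k (replication-equation x) (replication-equation y)

    ∑-intersection : ∀ a → ∑[ b < v ] intersection a b ≡ k * k
    ∑-intersection a = begin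
      ∑[ b < v ] intersection a b                     ≡⟨ ∑-*-∑-comm (N a) (λ x b → N b x) ⟨
      ∑[ x < v ] (N a x * replication x)              ≡⟨ sum-cong-≗ (λ x → cong (N a x *_) (replication≡k x)) ⟩
      ∑[ x < v ] (N a x * k)                          ≡⟨ ∑N*≡k* a k ⟩
      k * k                                           ∎

    ∑N*concurrence : ∀ a x → ∑[ y < v ] (N a y * concurrence x y) + N a x * lam ≡ k * lam + N a x * k
    ∑N*concurrence a x = begin
      ∑[ y < v ] (N a y * concurrence x y) + N a x * lam
        ≡⟨ ∑-differ-at x _ (λ y → N a y * lam) (λ y y≢x → cong (N a y *_) (concurrence≡lam (y≢x ∘ sym))) ⟩
      ∑[ y < v ] (N a y * lam) + N a x * concurrence x x
        ≡⟨ cong₂ _+_ (∑N*≡k* a lam) (cong (N a x *_) (trans (concurrence-diag x) (replication≡k x))) ⟩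
      k * lam + N a x * k ∎

    ∑-intersection² : ∀ a → ∑[ b < v ] (intersection a b * intersection a b) + k * lam ≡ k * (k * lam) + k * k
    ∑-intersection² a = begin
      ∑[ b < v ] (intersection a b * intersection a b) + k * lam
        ≡⟨ cong₂ _+_ (∑-square-expand (N a) N) (sym (∑N*≡k* a lam)) ⟩
      ∑[ x < v ] (N a x * Q x) + ∑[ x < v ] (N a x * lam)
        ≡⟨ ∑-distrib-+ (λ x → N a x * Q x) (λ x → N a x * lam) ⟨
      ∑[ x < v ] (N a x * Q x + N a x * lam)
        ≡⟨ sum-cong-≗ (λ x → trans (*-distribˡ-+ (N a x) _ _) (cong (N a x * Q x +_) (N*N*≡N* a x lam))) ⟨
      ∑[ x < v ] (N a x * (Q x + N a x * lam))
        ≡⟨ sum-cong-≗ (λ x → cong (N a x *_) (∑N*concurrence a x)) ⟩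
      ∑[ x < v ] (N a x * (k * lam + N a x * k))
        ≡⟨ sum-cong-≗ (λ x → trans (*-distribˡ-+ (N a x) _ _) (cong (N a x * (k * lam) +_) (N*N*≡N* a x k))) ⟩
      ∑[ x < v ] (N a x * (k * lam) + N a x * k)
        ≡⟨ ∑-distrib-+ (λ x → N a x * (k * lam)) (λ x → N a x * k) ⟩
      ∑[ x < v ] (N a x * (k * lam)) + ∑[ x < v ] (N a x * k)
        ≡⟨ cong₂ _+_ (∑N*≡k* a (k * lam)) (∑N*≡k* a k) ⟩
      k * (k * lam) + k * k ∎
      where
      Q : Fin v → ℕ
      Q x = ∑[ y < v ] (N a y * concurrence x y)

    module _ (a : Fin v) where

      -- Overwriting the entry intersection a a = k by λ leaves v entries of mean λ and variance 0.
      levelled : Fin v → ℕ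
      levelled = updateAt (intersection a) a (λ _ → lam)

      ∑levelled : ∀ h → ∑[ b < v ] h (levelled b) + h k ≡ ∑[ b < v ] h (intersection a b) + h lam
      ∑levelled h = begin
        ∑[ b < v ] h (levelled b) + h k
          ≡⟨ cong ((∑[ b < v ] h (levelled b) +_) ∘ h) (intersection-diag a) ⟨
        ∑[ b < v ] h (levelled b) + h (intersection a a)
          ≡⟨ ∑-differ-at a (h ∘ levelled) (h ∘ intersection a) agree ⟩
        ∑[ b < v ] h (intersection a b) + h (levelled a)
          ≡⟨ cong ((∑[ b < v ] h (intersection a b) +_) ∘ h) (updateAt-updates a (intersection a)) ⟩
        ∑[ b < v ] h (intersection a b) + h lam ∎
        where
        agree : ∀ b → b ≢ a → h (levelled b) ≡ h (intersection a b)
        agree b b≢a = cong h (updateAt-minimal b a (intersection a) b≢a)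

      k*k+lam≡v*lam+k : k * k + lam ≡ v * lam + k
      k*k+lam≡v*lam+k = subst (λ R → R * k + lam ≡ v * lam + R) (replication≡k a) (replication-equation a)

      ∑levelled≡v*lam : ∑[ b < v ] levelled b ≡ v * lam
      ∑levelled≡v*lam = +-cancelʳ-≡ k _ _ (begin
        ∑[ b < v ] levelled b + k          ≡⟨ ∑levelled (λ t → t) ⟩
        ∑[ b < v ] intersection a b + lam  ≡⟨ cong (_+ lam) (∑-intersection a) ⟩
        k * k + lam                        ≡⟨ k*k+lam≡v*lam+k ⟩
        v * lam + k                        ∎)

      ∑levelled²≡v*lam² : ∑[ b < v ] (levelled b * levelled b) ≡ v * (lam * lam)
      ∑levelled²≡v*lam² = +-cancelʳ-≡ (k * k + k * lam) _ _ (begin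
        ∑[ b < v ] (levelled b * levelled b) + (k * k + k * lam)
          ≡⟨ +-assoc _ (k * k) (k * lam) ⟨
        ∑[ b < v ] (levelled b * levelled b) + k * k + k * lam
          ≡⟨ cong (_+ k * lam) (∑levelled (λ t → t * t)) ⟩
        ∑[ b < v ] (intersection a b * intersection a b) + lam * lam + k * lam
          ≡⟨ xy∙z≈xz∙y +-commutativeSemigroup _ (lam * lam) (k * lam) ⟩
        ∑[ b < v ] (intersection a b * intersection a b) + k * lam + lam * lam
          ≡⟨ cong (_+ lam * lam) (∑-intersection² a) ⟩
        k * (k * lam) + k * k + lam * lam
          ≡⟨ regroup₁ k lam ⟩
        (k * k + lam) * lam + k * k
          ≡⟨ cong (λ t → t * lam + k * k) k*k+lam≡v*lam+k ⟩
        (v * lam + k) * lam + k * k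
          ≡⟨ regroup₂ v k lam ⟩
        v * (lam * lam) + (k * k + k * lam) ∎)
        where
        regroup₁ : ∀ k l → k * (k * l) + k * k + l * l ≡ (k * k + l) * l + k * k
        regroup₁ = solve-∀
        regroup₂ : ∀ v k l → (v * l + k) * l + k * k ≡ v * (l * l) + (k * k + k * l)
        regroup₂ = solve-∀

    ∣∩∣≡lam : ∀ {a b} → a ≢ b → ∣ B a ∩ B b ∣ ≡ lam
    ∣∩∣≡lam {a} {b} a≢b = begin
      ∣ B a ∩ B b ∣     ≡⟨ ∣p∩q∣≡∑𝟙*𝟙 (B a) (B b) ⟩
      intersection a b  ≡⟨ updateAt-minimal b a (intersection a) (a≢b ∘ sym) ⟨
      levelled a b      ≡⟨ ∑≡n*l⇒∑²≡n*l²⇒≡l (levelled a) lam (∑levelled≡v*lam a) (∑levelled²≡v*lam² a) b ⟩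
      lam               ∎

module TripleArrayFromDesign {r c lam : ℕ} {B : Fin (r + c) → Subset (r + c)}
                             (D : IsSymmetricDesign (r + c) r lam B) (1<r : 1 < r) (σ : Fin (r + c)) where
  open IsSymmetricDesign D
  open SymmetricDesign D
  open ≡-Reasoning

  σ∈?B : Decidable (λ b → σ ∈ B b)
  σ∈?B b = σ ∈? B b

  σ∉?B : Decidable (λ b → σ ∉ B b)
  σ∉?B b = ¬? (σ ∈? B b)

  𝟙[σ∈B]≡N : ∀ b → 𝟙 (does (σ∈?B b)) ≡ N b σ
  𝟙[σ∈B]≡N b = cong 𝟙 (does-∈? σ (B b))

  #blocks∋σ : ∑[ b < r + c ] 𝟙 (does (σ∈?B b)) ≡ r
  #blocks∋σ = trans (sum-cong-≗ 𝟙[σ∈B]≡N) (replication≡k 1<r σ)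

  #blocks∌σ : ∑[ b < r + c ] 𝟙 (does (σ∉?B b)) ≡ c
  #blocks∌σ = +-cancelʳ-≡ r _ _ (begin
    ∑[ b < r + c ] 𝟙 (does (σ∉?B b)) + r
      ≡⟨ cong (∑[ b < r + c ] 𝟙 (does (σ∉?B b)) +_) #blocks∋σ ⟨
    ∑[ b < r + c ] 𝟙 (does (σ∉?B b)) + ∑[ b < r + c ] 𝟙 (does (σ∈?B b))
      ≡⟨ ∑-distrib-+ (𝟙 ∘ does ∘ σ∉?B) (𝟙 ∘ does ∘ σ∈?B) ⟨
    ∑[ b < r + c ] (𝟙 (does (σ∉?B b)) + 𝟙 (does (σ∈?B b)))
      ≡⟨ sum-cong-≗ (𝟙-not ∘ does ∘ σ∈?B) ⟩
    ∑[ b < r + c ] 1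
      ≡⟨ trans (∑-const (r + c) 1) (*-identityʳ (r + c)) ⟩
    r + c
      ≡⟨ +-comm r c ⟩
    c + r ∎)

  enumerations : Enumeration r (λ b → σ ∈ B b) × Enumeration c (λ b → σ ∉ B b)
  enumerations = subst (λ m → Enumeration m (λ b → σ ∈ B b)) #blocks∋σ (enumerate σ∈?B)
               , subst (λ m → Enumeration m (λ b → σ ∉ B b)) #blocks∌σ (enumerate σ∉?B)

  ∑[σ∈B]*N≡lam : ∀ {x} → x ≢ σ → ∑[ b < r + c ] (𝟙 (does (σ∈?B b)) * N b x) ≡ lam
  ∑[σ∈B]*N≡lam x≢σ = trans (sum-cong-≗ (λ b → cong (_* N b _) (𝟙[σ∈B]≡N b))) (concurrence≡lam (x≢σ ∘ sym))

  module _ (rowB : Fin r → Fin (r + c)) (rowB-enum : Enumerates rowB (λ b → σ ∈ B b))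
           (colB : Fin c → Fin (r + c)) (colB-enum : Enumerates colB (λ b → σ ∉ B b)) where

    R : Fin r → Subset (r + c)
    R i = ∁ (B (rowB i))

    C : Fin c → Subset (r + c)
    C j = B (colB j)

    σ∈B[rowB] : ∀ i → σ ∈ B (rowB i)
    σ∈B[rowB] = proj₁ (proj₂ rowB-enum)

    σ∉B[colB] : ∀ j → σ ∉ B (colB j)
    σ∉B[colB] = proj₁ (proj₂ colB-enum)

    rowB≢colB : ∀ i j → rowB i ≢ colB j
    rowB≢colB i j eq = σ∉B[colB] j (subst (λ b → σ ∈ B b) eq (σ∈B[rowB] i))

    x∈V⇒x≢σ : ∀ {x} → x ∈ ∁ ⁅ σ ⁆ → x ≢ σ
    x∈V⇒x≢σ x∈V = x∉⁅y⁆⇒x≢y (x∈∁p⇒x∉p x∈V)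

    rowRep : ∀ x → x ∈ ∁ ⁅ σ ⁆ → count (λ i → lookup (R i) x) ≡ r ∸ lam
    rowRep x x∈V = trans (count≡∑𝟙 (λ i → lookup (R i) x)) (m+n≡o⇒m≡o∸n (begin
      ∑[ i < r ] 𝟙 (lookup (R i) x) + lam
        ≡⟨ cong (∑[ i < r ] 𝟙 (lookup (R i) x) +_)
                (trans (∑-Enumerates σ∈?B rowB-enum (λ b → N b x)) (∑[σ∈B]*N≡lam (x∈V⇒x≢σ x∈V))) ⟨
      ∑[ i < r ] 𝟙 (lookup (R i) x) + ∑[ i < r ] N (rowB i) x
        ≡⟨ ∑-distrib-+ (λ i → 𝟙 (lookup (R i) x)) (λ i → N (rowB i) x) ⟨
      ∑[ i < r ] (𝟙 (lookup (R i) x) + N (rowB i) x)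
        ≡⟨ sum-cong-≗ (λ i → 𝟙-∁ (B (rowB i)) x) ⟩
      ∑[ i < r ] 1
        ≡⟨ trans (∑-const r 1) (*-identityʳ r) ⟩
      r ∎))

    colRep : ∀ x → x ∈ ∁ ⁅ σ ⁆ → count (λ j → lookup (C j) x) ≡ r ∸ lam
    colRep x x∈V = trans (count≡∑𝟙 (λ j → lookup (C j) x)) (m+n≡o⇒m≡o∸n (begin
      ∑[ j < c ] N (colB j) x + lam
        ≡⟨ cong₂ _+_ (∑-Enumerates σ∉?B colB-enum (λ b → N b x)) (sym (∑[σ∈B]*N≡lam (x∈V⇒x≢σ x∈V))) ⟩
      ∑[ b < r + c ] (𝟙 (does (σ∉?B b)) * N b x) + ∑[ b < r + c ] (𝟙 (does (σ∈?B b)) * N b x)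
        ≡⟨ ∑-distrib-+ (λ b → 𝟙 (does (σ∉?B b)) * N b x) (λ b → 𝟙 (does (σ∈?B b)) * N b x) ⟨
      ∑[ b < r + c ] (𝟙 (does (σ∉?B b)) * N b x + 𝟙 (does (σ∈?B b)) * N b x)
        ≡⟨ sum-cong-≗ (λ b → split (does (σ∈?B b)) (N b x)) ⟩
      replication x
        ≡⟨ replication≡k 1<r x ⟩
      r ∎))
      where
      split : ∀ a t → 𝟙 (not a) * t + 𝟙 a * t ≡ t
      split a t = trans (sym (*-distribʳ-+ t (𝟙 (not a)) (𝟙 a))) (trans (cong (_* t) (𝟙-not a)) (*-identityˡ t))

    rowCol : ∀ i j → ∣ R i ∩ C j ∣ ≡ r ∸ lam
    rowCol i j = m+n≡o⇒m≡o∸n (begin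
      ∣ R i ∩ C j ∣ + lam                        ≡⟨ cong (∣ R i ∩ C j ∣ +_) (∣∩∣≡lam 1<r (rowB≢colB i j)) ⟨
      ∣ R i ∩ C j ∣ + ∣ B (rowB i) ∩ C j ∣       ≡⟨ ∣∁p∩q∣+∣p∩q∣≡∣q∣ (B (rowB i)) (C j) ⟩
      ∣ C j ∣                                    ≡⟨ blockSize (colB j) ⟩
      r                                          ∎)

    rowRow : ∀ i s → i ≢ s → ∣ R i ∩ R s ∣ ≡ r + c + lam ∸ (r + r)
    rowRow i s i≢s = m+n≡o⇒m≡o∸n (begin
      ∣ R i ∩ R s ∣ + (r + r)
        ≡⟨ cong (λ t → ∣ R i ∩ R s ∣ + t) (cong₂ _+_ (blockSize (rowB i)) (blockSize (rowB s))) ⟨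
      ∣ R i ∩ R s ∣ + (∣ B (rowB i) ∣ + ∣ B (rowB s) ∣)
        ≡⟨ ∣∁p∩∁q∣+[∣p∣+∣q∣]≡n+∣p∩q∣ (B (rowB i)) (B (rowB s)) ⟩
      r + c + ∣ B (rowB i) ∩ B (rowB s) ∣
        ≡⟨ cong (r + c +_) (∣∩∣≡lam 1<r (i≢s ∘ proj₁ rowB-enum)) ⟩
      r + c + lam ∎)

    tripleArray : IsUnorderedTripleArray r c (r + c ∸ 1) (∁ ⁅ σ ⁆) R C
    tripleArray = record
      { symbolCount = trans (∣∁p∣≡n∸∣p∣ ⁅ σ ⁆) (cong (r + c ∸_) (∣⁅x⁆∣≡1 σ))
      ; rowsIn      = λ i → x∉p⇒p⊆∁⁅x⁆ (x∈p⇒x∉∁p (σ∈B[rowB] i))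
      ; colsIn      = λ j → x∉p⇒p⊆∁⁅x⁆ (σ∉B[colB] j)
      ; rowSize     = λ i → trans (∣∁p∣≡n∸∣p∣ (B (rowB i))) (trans (cong (r + c ∸_) (blockSize (rowB i))) (m+n∸m≡n r c))
      ; colSize     = λ j → blockSize (colB j)
      ; rowRep      = rowRep
      ; colRep      = colRep
      ; rowCol      = rowCol
      ; rowRow      = rowRow
      ; colCol      = λ j t j≢t → ∣∩∣≡lam 1<r (j≢t ∘ proj₁ colB-enum)
      }

proposition1 : (r c lamcc : ℕ) → 0 < r → 0 < c → 0 < lamcc →
    (B : Fin (r + c) → Subset (r + c)) → IsSymmetricDesign (r + c) r lamcc B →
    (σ : Fin (r + c)) →
    ((Σ (Fin r → Fin (r + c)) λ rowB → Enumerates rowB (λ b → σ ∈ B b))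
      × (Σ (Fin c → Fin (r + c)) λ colB → Enumerates colB (λ b → σ ∉ B b)))
    × ((rowB : Fin r → Fin (r + c)) → Enumerates rowB (λ b → σ ∈ B b) →
       (colB : Fin c → Fin (r + c)) → Enumerates colB (λ b → σ ∉ B b) →
       IsUnorderedTripleArray r c (r + c ∸ 1) (∁ ⁅ σ ⁆)
         (λ i → ∁ (B (rowB i))) (λ j → B (colB j)))
proposition1 r c lamcc 0<r 0<c 0<lamcc B D σ = enumerations , tripleArray
  where
  open TripleArrayFromDesign D (SymmetricDesign.1<v⇒0<lam⇒1<k D (+-mono-≤ 0<r 0<c) 0<lamcc) σ
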